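{- For every integer $t\ge2$, as $n\to\infty$ both $\operatorname{fdim}_t(A_n)$ and $\operatorname{fldim}_t(A_n)$ equal $\frac{2t}{t-1}-o(1)$, i.e. both converge to $\frac{2t}{t-1}$, where $A_n$ is the $n$-element antichain.
   Context: $\mathbf{t}$ denotes the $t$-element chain. A partial function $f$ from a poset $P$ to $\mathbf{t}$ is monotone if $x\le y$ with $x,y\in\operatorname{dom}(f)$ implies $f(x)\le f(y)$. A fractional local $t$-realiser of a finite poset $P$ is a function $w$ assigning a nonnegative weight to each monotone partial function $f$ from $P$ to $\mathbf{t}$ such that for every pair $x\not\ge y$, $\sum\{w(f): x,y\in\operatorname{dom}(f),\ f(x)<f(y)\}\ge1$; it is a fractional $t$-realiser if it gives positive weight only to total functions. The fractional local $t$-dimension $\operatorname{fldim}_t(P)$ (resp. fractional $t$-dimension $\operatorname{fdim}_t(P)$) is the minimum over all fractional local $t$-realisers (resp. fractional $t$-realisers) $w$ of $\max_{x\in P}\sum_{f:\,x\in\operatorname{dom}(f)}w(f)$.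
   Formalization: The weights that fractional local $t$-realisers and fractional $t$-realisers assign to monotone partial functions are nonnegative rationals. -}

module Defs where

open import Data.Nat as ℕ using (ℕ; zero; suc)
open import Data.Integer using (+_)
open import Data.Fin as Fin using (Fin)
open import Data.Maybe using (Maybe; just; nothing)
open import Data.List using (List; []; _∷_)
open import Data.List.Relation.Unary.All using (All)
open import Data.Product using (_×_; _,_; ∃)
open import Data.Rational using (ℚ; 0ℚ; 1ℚ; _+_; _-_; _≤_; _/_)
open import Relation.Binary.PropositionalEquality using (_≡_)
open import Relation.Nullary using (¬_; yes; no)

-- A finite poset on Fin n is given by its order relation R (R x y means x ≤ y).
-- The n-element antichain: x ≤ y iff x = y.
Antichain : (n : ℕ) → Fin n → Fin n → Set
Antichain n x y = x ≡ y

-- Partial functions from Fin n to the t-element chain Fin t (nothing = undefined).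
PFun : ℕ → ℕ → Set
PFun n t = Fin n → Maybe (Fin t)

Monotone : ∀ {n t} → (Fin n → Fin n → Set) → PFun n t → Set
Monotone {n} {t} R f =
  ∀ (x y : Fin n) (a b : Fin t) → R x y → f x ≡ just a → f y ≡ just b → a Fin.≤ b

Total : ∀ {n t} → PFun n t → Set
Total {n} {t} f = ∀ (x : Fin n) → ∃ λ (a : Fin t) → f x ≡ just a

-- A weighting of (finitely many) partial functions, as a finite list of
-- (function, weight) pairs; the weight of f is the sum of its entries.
Weighting : ℕ → ℕ → Set
Weighting n t = List (PFun n t × ℚ)

sepW : ∀ {n t} → PFun n t → ℚ → Fin n → Fin n → ℚ
sepW f q x y with f x | f y
... | just a | just b with a Fin.<? b
...   | yes _ = q
...   | no _ = 0ℚ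
sepW f q x y | _ | _ = 0ℚ

loadW : ∀ {n t} → PFun n t → ℚ → Fin n → ℚ
loadW f q x with f x
... | just _ = q
... | nothing = 0ℚ

sepSum : ∀ {n t} → Weighting n t → Fin n → Fin n → ℚ
sepSum [] x y = 0ℚ
sepSum ((f , q) ∷ w) x y = sepW f q x y + sepSum w x y

load : ∀ {n t} → Weighting n t → Fin n → ℚ
load [] x = 0ℚ
load ((f , q) ∷ w) x = loadW f q x + load w x

ValidWeighting : ∀ {n t} → (Fin n → Fin n → Set) → Weighting n t → Set
ValidWeighting R w = All (λ p → Monotone R (Data.Product.proj₁ p) × 0ℚ ≤ Data.Product.proj₂ p) w

FracLocalRealiser : ∀ {n} (t : ℕ) → (Fin n → Fin n → Set) → Weighting n t → Set
FracLocalRealiser {n} t R w =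
  ValidWeighting R w × (∀ (x y : Fin n) → ¬ R y x → 1ℚ ≤ sepSum w x y)

FracRealiser : ∀ {n} (t : ℕ) → (Fin n → Fin n → Set) → Weighting n t → Set
FracRealiser t R w =
  FracLocalRealiser t R w × All (λ p → Total (Data.Product.proj₁ p)) w

FLDimAtMost : ∀ {n} (t : ℕ) → (Fin n → Fin n → Set) → ℚ → Set
FLDimAtMost {n} t R c = ∃ λ (w : Weighting n t) → FracLocalRealiser t R w × (∀ x → load w x ≤ c)

FLDimAtLeast : ∀ {n} (t : ℕ) → (Fin n → Fin n → Set) → ℚ → Set
FLDimAtLeast {n} t R c = ∀ (w : Weighting n t) → FracLocalRealiser t R w → ∃ λ x → c ≤ load w x

FDimAtMost : ∀ {n} (t : ℕ) → (Fin n → Fin n → Set) → ℚ → Set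
FDimAtMost {n} t R c = ∃ λ (w : Weighting n t) → FracRealiser t R w × (∀ x → load w x ≤ c)

FDimAtLeast : ∀ {n} (t : ℕ) → (Fin n → Fin n → Set) → ℚ → Set
FDimAtLeast {n} t R c = ∀ (w : Weighting n t) → FracRealiser t R w → ∃ λ x → c ≤ load w x

-- 2t/(t-1) for t ≥ 2
limitValue : (t : ℕ) → 2 ℕ.≤ t → ℚ
limitValue (suc zero) (ℕ.s≤s ())
limitValue (suc (suc k)) _ = (+ (2 ℕ.* suc (suc k))) / suc k

-- Write t = k + 1 and L = 2t/k.
--
-- Upper bound: give every one of the tⁿ total maps Fin n → Fin t the weight 2t/(k tⁿ). Each point
-- then has load exactly L, and for x ≠ y the maps with g x < g y make up a fraction k/(2t) of all
-- maps, so every ordered pair of distinct points is separated with weight exactly 1.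
--
-- Lower bound: for a partial map f into the chain with domain of size D and fibres of sizes c_a,
-- the number I of ordered pairs with f x < f y satisfies D² = 2I + Σ c_a² ≥ 2I + D²/t by
-- Cauchy–Schwarz, hence 2tI ≤ k n D. Summing over a fractional local realiser of Aₙ, whose total
-- separation is at least n(n-1), gives 2t n(n-1) ≤ k n · Σₓ load(x), so some point has load at
-- least L (n-1)/n = L - L/n.

module Submission where

open import Algebra.Bundles using (Ring)
import Algebra.Properties.Semiring.Mult as SemiringMult
import Algebra.Properties.Semiring.Sum as SemiringSum
open import Data.Empty using (⊥-elim)
open import Data.Fin as Fin using (Fin; zero; suc)
import Data.Fin.Properties as Finₚ
open import Data.Integer as ℤ using (-[1+_])
import Data.Integer.Properties as ℤₚ
import Data.Integer.Solver as ℤSolver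
open import Data.List using (List; []; _∷_; _++_; map; length; allFin)
open import Data.List.Membership.Propositional.Properties using (∈-allFin)
import Data.List.Extrema as Extrema
open import Data.List.Relation.Unary.All as All using (All; []; _∷_)
open import Data.Maybe using (Maybe; just; nothing)
import Data.Maybe.Properties as Maybeₚ
open import Data.Nat as ℕ using (ℕ; zero; suc; _^_; _≤_; z≤n; s≤s)
import Data.Nat.Properties as ℕₚ
import Data.Nat.Solver as ℕSolver
open import Data.Product using (_×_; _,_; ∃; proj₁; proj₂)
open import Data.Rational as ℚ using (ℚ; mkℚ; 0ℚ; 1ℚ; _+_; _*_; _-_; _<_; _/_; toℚᵘ; *<*)
import Data.Rational.Properties as ℚₚ
import Data.Rational.Solver as ℚSolver
import Data.Rational.Unnormalised as ℚᵘ
import Data.Rational.Unnormalised.Properties as ℚᵘₚ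
open import Data.Sum using (inj₁; inj₂)
import Data.Vec.Functional as Vector
open import Function using (_∘_)
open import Relation.Binary using (DecTotalOrder)
open import Relation.Binary.PropositionalEquality
open import Relation.Nullary using (¬_; yes; no)

open import Defs

module ℚ-Mult = SemiringMult (Ring.semiring ℚₚ.+-*-ring)

-- As n × 1ℚ, fromℕ (suc n) reduces to 1ℚ + fromℕ n.
fromℕ : ℕ → ℚ
fromℕ n = n ℚ-Mult.× 1ℚ

fromℕ-+ : ∀ m n → fromℕ (m ℕ.+ n) ≡ fromℕ m + fromℕ n
fromℕ-+ = ℚ-Mult.×-homo-+ 1ℚ

fromℕ-* : ∀ m n → fromℕ (m ℕ.* n) ≡ fromℕ m * fromℕ n
fromℕ-* = ℚ-Mult.×1-homo-*

fromℕ-2* : ∀ n → fromℕ (2 ℕ.* n) ≡ fromℕ n + fromℕ n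
fromℕ-2* n = trans (fromℕ-+ n (1 ℕ.* n)) (cong (λ m → fromℕ n + fromℕ m) (ℕₚ.*-identityˡ n))

fromℕ-nonNeg : ∀ n → 0ℚ ℚ.≤ fromℕ n
fromℕ-pos : ∀ n → 0ℚ < fromℕ (suc n)

fromℕ-nonNeg zero = ℚₚ.≤-refl
fromℕ-nonNeg (suc n) = ℚₚ.<⇒≤ (fromℕ-pos n)

fromℕ-pos n = ℚₚ.+-mono-<-≤ {0ℚ} {1ℚ} {0ℚ} (ℚ.*<* (ℤ.+<+ (s≤s z≤n))) (fromℕ-nonNeg n)

fromℕ-mono-≤ : ∀ {m n} → m ≤ n → fromℕ m ℚ.≤ fromℕ n
fromℕ-mono-≤ {m} {n} m≤n = begin
  fromℕ m                 ≡⟨ ℚₚ.+-identityʳ (fromℕ m) ⟨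
  fromℕ m + 0ℚ            ≤⟨ ℚₚ.+-monoʳ-≤ (fromℕ m) (fromℕ-nonNeg (n ℕ.∸ m)) ⟩
  fromℕ m + fromℕ (n ℕ.∸ m) ≡⟨ fromℕ-+ m (n ℕ.∸ m) ⟨
  fromℕ (m ℕ.+ (n ℕ.∸ m))  ≡⟨ cong fromℕ (ℕₚ.m+[n∸m]≡n m≤n) ⟩
  fromℕ n                 ∎
  where open ℚₚ.≤-Reasoning

toℚᵘ-fromℕ : ∀ n → toℚᵘ (fromℕ n) ℚᵘ.≃ ℚᵘ.mkℚᵘ (ℤ.+ n) 0
toℚᵘ-fromℕ zero = ℚᵘ.*≡* refl
toℚᵘ-fromℕ (suc n) = ℚᵘₚ.≃-trans (ℚₚ.toℚᵘ-homo-+ 1ℚ (fromℕ n))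
  (ℚᵘₚ.≃-trans (ℚᵘₚ.+-congʳ (toℚᵘ 1ℚ) (toℚᵘ-fromℕ n))
    (ℚᵘ.*≡* (solve 1 (λ n → (con (ℤ.+ 1) :* con (ℤ.+ 1) :+ n :* con (ℤ.+ 1)) :* con (ℤ.+ 1) := (con (ℤ.+ 1) :+ n) :* con (ℤ.+ 1)) refl (ℤ.+ n))))
  where open ℤSolver.+-*-Solver

a/d*d≡a : ∀ a d .{{_ : ℕ.NonZero d}} → (ℤ.+ a / d) * fromℕ d ≡ fromℕ a
a/d*d≡a a (suc d-1) = ℚₚ.toℚᵘ-injective (begin
  toℚᵘ ((ℤ.+ a / suc d-1) * fromℕ (suc d-1))
    ≈⟨ ℚₚ.toℚᵘ-homo-* (ℤ.+ a / suc d-1) (fromℕ (suc d-1)) ⟩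
  toℚᵘ (ℤ.+ a / suc d-1) ℚᵘ.* toℚᵘ (fromℕ (suc d-1))
    ≈⟨ ℚᵘₚ.*-cong (ℚₚ.toℚᵘ-fromℚᵘ (ℚᵘ.mkℚᵘ (ℤ.+ a) d-1)) (toℚᵘ-fromℕ (suc d-1)) ⟩
  ℚᵘ.mkℚᵘ (ℤ.+ a) d-1 ℚᵘ.* ℚᵘ.mkℚᵘ (ℤ.+ suc d-1) 0
    ≈⟨ ℚᵘ.*≡* (solve 2 (λ a d → (a :* d) :* con (ℤ.+ 1) := a :* (d :* con (ℤ.+ 1))) refl (ℤ.+ a) (ℤ.+ suc d-1)) ⟩
  ℚᵘ.mkℚᵘ (ℤ.+ a) 0
    ≈⟨ toℚᵘ-fromℕ a ⟨
  toℚᵘ (fromℕ a) ∎)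
  where
  open ℚᵘₚ.≃-Reasoning
  open ℤSolver.+-*-Solver

a/d≤a : ∀ a d .{{_ : ℕ.NonZero d}} → ℤ.+ a / d ℚ.≤ fromℕ a
a/d≤a a d@(suc d-1) = begin
  ℤ.+ a / d                ≡⟨ ℚₚ.*-identityʳ (ℤ.+ a / d) ⟨
  ℤ.+ a / d * 1ℚ           ≤⟨ ℚₚ.*-monoˡ-≤-nonNeg (ℤ.+ a / d) {{ℚₚ.normalize-nonNeg a d}} (fromℕ-mono-≤ {1} {d} (s≤s z≤n)) ⟩
  ℤ.+ a / d * fromℕ d      ≡⟨ a/d*d≡a a d ⟩
  fromℕ a                  ∎
  where open ℚₚ.≤-Reasoning

archimedean : ∀ a ε → 0ℚ < ε → ∃ λ N → ∀ n → N ≤ n → fromℕ a ℚ.≤ ε * fromℕ n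
archimedean a ε@(mkℚ (ℤ.+ suc p) d-1 _) 0<ε = a ℕ.* suc d-1 , λ n N≤n → begin
  fromℕ a                           ≤⟨ fromℕ-mono-≤ (ℕₚ.m≤m*n a (suc p)) ⟩
  fromℕ (a ℕ.* suc p)               ≡⟨ fromℕ-* a (suc p) ⟩
  fromℕ a * fromℕ (suc p)           ≡⟨ cong (fromℕ a *_) ε*d≡1+p ⟨
  fromℕ a * (ε * fromℕ (suc d-1))  ≡⟨ solve 3 (λ a e d → a :* (e :* d) := e :* (a :* d)) refl (fromℕ a) ε (fromℕ (suc d-1)) ⟩
  ε * (fromℕ a * fromℕ (suc d-1))  ≡⟨ cong (ε *_) (fromℕ-* a (suc d-1)) ⟨
  ε * fromℕ (a ℕ.* suc d-1)         ≤⟨ ℚₚ.*-monoˡ-≤-nonNeg ε {{ℚ.nonNegative (ℚₚ.<⇒≤ 0<ε)}} (fromℕ-mono-≤ N≤n) ⟩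
  ε * fromℕ n                       ∎
  where
  open ℚₚ.≤-Reasoning
  open ℚSolver.+-*-Solver
  ε*d≡1+p : ε * fromℕ (suc d-1) ≡ fromℕ (suc p)
  ε*d≡1+p = trans (cong (_* fromℕ (suc d-1)) (sym (ℚₚ.↥p/↧p≡p ε))) (a/d*d≡a (suc p) (suc d-1))
archimedean a (mkℚ (ℤ.+ zero) d-1 _) (*<* 0<0) = ⊥-elim (ℤₚ.<-irrefl refl 0<0)
archimedean a (mkℚ -[1+ p ] d-1 _) (*<* ())

module ℕ-Sum = SemiringSum ℕₚ.+-*-semiring
open ℕ-Sum using (sum; ∑-distrib-+; ∑-comm; sum-cong-≗)

sum-const : ∀ n k → sum {n} (λ _ → k) ≡ n ℕ.* k
sum-const zero k = refl
sum-const (suc n) k = cong (k ℕ.+_) (sum-const n k)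

sum-zero : ∀ n → sum {n} (λ _ → 0) ≡ 0
sum-zero n = trans (sum-const n 0) (ℕₚ.*-zeroʳ n)

sum-mono-≤ : ∀ {n} {f g : Fin n → ℕ} → (∀ i → f i ≤ g i) → sum f ≤ sum g
sum-mono-≤ {zero} f≤g = z≤n
sum-mono-≤ {suc n} f≤g = ℕₚ.+-mono-≤ (f≤g zero) (sum-mono-≤ (λ i → f≤g (suc i)))

sum-*-sum : ∀ {m n} (f : Fin m → ℕ) (g : Fin n → ℕ) → sum f ℕ.* sum g ≡ sum (λ i → sum (λ j → f i ℕ.* g j))
sum-*-sum f g = trans (ℕ-Sum.*-distribʳ-sum (sum g) f) (sum-cong-≗ (λ i → ℕ-Sum.*-distribˡ-sum (f i) g))

∑∑-distrib-+ : ∀ {m n} (f g : Fin m → Fin n → ℕ) →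
  sum (λ i → sum (λ j → f i j ℕ.+ g i j)) ≡ sum (λ i → sum (f i)) ℕ.+ sum (λ i → sum (g i))
∑∑-distrib-+ f g = trans (sum-cong-≗ (λ i → ∑-distrib-+ (f i) (g i))) (∑-distrib-+ (λ i → sum (f i)) (λ i → sum (g i)))

m*n+m*n≤m*m+n*n : ∀ m n → m ℕ.* n ℕ.+ m ℕ.* n ≤ m ℕ.* m ℕ.+ n ℕ.* n
m*n+m*n≤m*m+n*n m n with ℕₚ.≤-total m n
... | inj₁ m≤n = subst (λ n → m ℕ.* n ℕ.+ m ℕ.* n ≤ m ℕ.* m ℕ.+ n ℕ.* n) (ℕₚ.m+[n∸m]≡n m≤n) (gapʳ m (n ℕ.∸ m))
  where
  open ℕSolver.+-*-Solver
  gapʳ : ∀ m d → m ℕ.* (m ℕ.+ d) ℕ.+ m ℕ.* (m ℕ.+ d) ≤ m ℕ.* m ℕ.+ (m ℕ.+ d) ℕ.* (m ℕ.+ d)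
  gapʳ m d = ℕₚ.≤-trans (ℕₚ.m≤m+n _ (d ℕ.* d)) (ℕₚ.≤-reflexive
    (solve 2 (λ m d → m :* (m :+ d) :+ m :* (m :+ d) :+ d :* d := m :* m :+ (m :+ d) :* (m :+ d)) refl m d))
... | inj₂ n≤m = subst (λ m → m ℕ.* n ℕ.+ m ℕ.* n ≤ m ℕ.* m ℕ.+ n ℕ.* n) (ℕₚ.m+[n∸m]≡n n≤m) (gapˡ n (m ℕ.∸ n))
  where
  open ℕSolver.+-*-Solver
  gapˡ : ∀ n d → (n ℕ.+ d) ℕ.* n ℕ.+ (n ℕ.+ d) ℕ.* n ≤ (n ℕ.+ d) ℕ.* (n ℕ.+ d) ℕ.+ n ℕ.* n
  gapˡ n d = ℕₚ.≤-trans (ℕₚ.m≤m+n _ (d ℕ.* d)) (ℕₚ.≤-reflexive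
    (solve 2 (λ n d → (n :+ d) :* n :+ (n :+ d) :* n :+ d :* d := (n :+ d) :* (n :+ d) :+ n :* n) refl n d))

cauchy-schwarz : ∀ t (c : Fin t → ℕ) → sum c ℕ.* sum c ≤ t ℕ.* sum (λ a → c a ℕ.* c a)
cauchy-schwarz t c = ℕₚ.*-cancelˡ-≤ 2 (begin
  2 ℕ.* (sum c ℕ.* sum c)                                   ≡⟨ cong (2 ℕ.*_) (sum-*-sum c c) ⟩
  2 ℕ.* sum (λ a → sum (λ b → c a ℕ.* c b))                 ≡⟨ ℕ-Sum.*-distribˡ-sum 2 (λ a → sum (λ b → c a ℕ.* c b)) ⟩
  sum (λ a → 2 ℕ.* sum (λ b → c a ℕ.* c b))                 ≡⟨ sum-cong-≗ (λ a → ℕ-Sum.*-distribˡ-sum 2 (λ b → c a ℕ.* c b)) ⟩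
  sum (λ a → sum (λ b → 2 ℕ.* (c a ℕ.* c b)))               ≤⟨ sum-mono-≤ (λ a → sum-mono-≤ (λ b → double≤ a b)) ⟩
  sum (λ a → sum (λ b → c a ℕ.* c a ℕ.+ c b ℕ.* c b))       ≡⟨ sum-cong-≗ (λ a → ∑-distrib-+ (λ _ → c a ℕ.* c a) (λ b → c b ℕ.* c b)) ⟩
  sum (λ a → sum {t} (λ _ → c a ℕ.* c a) ℕ.+ Q)             ≡⟨ ∑-distrib-+ (λ a → sum {t} (λ _ → c a ℕ.* c a)) (λ _ → Q) ⟩
  sum (λ a → sum {t} (λ _ → c a ℕ.* c a)) ℕ.+ sum {t} (λ _ → Q)
    ≡⟨ cong₂ ℕ._+_ (trans (sum-cong-≗ (λ a → sum-const t (c a ℕ.* c a))) (sym (ℕ-Sum.*-distribˡ-sum t (λ a → c a ℕ.* c a)))) (sum-const t Q) ⟩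
  t ℕ.* Q ℕ.+ t ℕ.* Q                                       ≡⟨ cong (t ℕ.* Q ℕ.+_) (ℕₚ.+-identityʳ (t ℕ.* Q)) ⟨
  2 ℕ.* (t ℕ.* Q)                                           ∎)
  where
  open ℕₚ.≤-Reasoning
  Q : ℕ
  Q = sum (λ a → c a ℕ.* c a)
  double≤ : ∀ a b → 2 ℕ.* (c a ℕ.* c b) ≤ c a ℕ.* c a ℕ.+ c b ℕ.* c b
  double≤ a b = subst (_≤ c a ℕ.* c a ℕ.+ c b ℕ.* c b)
    (cong (c a ℕ.* c b ℕ.+_) (sym (ℕₚ.+-identityʳ _))) (m*n+m*n≤m*m+n*n (c a) (c b))

module ℚ-Sum = SemiringSum (Ring.semiring ℚₚ.+-*-ring)
open ℚ-Sum using () renaming (sum to sumℚ)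

sumℚ-mono-≤ : ∀ {n} {f g : Fin n → ℚ} → (∀ i → f i ℚ.≤ g i) → sumℚ f ℚ.≤ sumℚ g
sumℚ-mono-≤ {zero} f≤g = ℚₚ.≤-refl
sumℚ-mono-≤ {suc n} f≤g = ℚₚ.+-mono-≤ (f≤g zero) (sumℚ-mono-≤ (λ i → f≤g (suc i)))

fromℕ-sum : ∀ {n} (g : Fin n → ℕ) → fromℕ (sum g) ≡ sumℚ (λ i → fromℕ (g i))
fromℕ-sum {zero} g = refl
fromℕ-sum {suc n} g = trans (fromℕ-+ (g zero) (sum (g ∘ suc))) (cong (fromℕ (g zero) +_) (fromℕ-sum (g ∘ suc)))

sumℚ-*-fromℕ : ∀ {n} q (g : Fin n → ℕ) → sumℚ (λ i → q * fromℕ (g i)) ≡ q * fromℕ (sum g)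
sumℚ-*-fromℕ q g = trans (sym (ℚ-Sum.*-distribˡ-sum q (λ i → fromℕ (g i)))) (cong (q *_) (sym (fromℕ-sum g)))

module ℚ-Extrema = Extrema (DecTotalOrder.totalOrder ℚₚ.≤-decTotalOrder)

sumℚ≤size*max : ∀ {m} (g : Fin (suc m) → ℚ) → ∃ λ x → sumℚ g ℚ.≤ fromℕ (suc m) * g x
sumℚ≤size*max {m} g = x , (begin
  sumℚ g                    ≤⟨ sumℚ-mono-≤ {f = g} (λ y → All.lookup (ℚ-Extrema.f[xs]≤f[argmax] {f = g} zero (allFin (suc m))) (∈-allFin y)) ⟩
  sumℚ {suc m} (λ _ → g x)  ≡⟨ ℚ-Sum.sum-replicate (suc m) {g x} ⟩
  suc m ℚ-Mult.× g x        ≡⟨ cong (suc m ℚ-Mult.×_) (ℚₚ.*-identityˡ (g x)) ⟨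
  suc m ℚ-Mult.× (1ℚ * g x) ≡⟨ ℚ-Mult.×-assoc-* (suc m) 1ℚ (g x) ⟨
  fromℕ (suc m) * g x       ∎)
  where
  open ℚₚ.≤-Reasoning
  x : Fin (suc m)
  x = ℚ-Extrema.argmax g zero (allFin (suc m))

-- Counting on a chain
δ : ∀ {t} → Fin t → Fin t → ℕ
δ zero zero = 1
δ zero (suc b) = 0
δ (suc a) zero = 0
δ (suc a) (suc b) = δ a b

less : ∀ {t} → Fin t → Fin t → ℕ
less zero zero = 0
less zero (suc b) = 1
less (suc a) zero = 0
less (suc a) (suc b) = less a b

δ-sym : ∀ {t} (a b : Fin t) → δ a b ≡ δ b a
δ-sym zero zero = refl
δ-sym zero (suc b) = refl
δ-sym (suc a) zero = refl
δ-sym (suc a) (suc b) = δ-sym a b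

δ-refl : ∀ {t} (a : Fin t) → δ a a ≡ 1
δ-refl zero = refl
δ-refl (suc a) = δ-refl a

δ-≢ : ∀ {t} {a b : Fin t} → ¬ a ≡ b → δ a b ≡ 0
δ-≢ {a = zero} {zero} a≢b = ⊥-elim (a≢b refl)
δ-≢ {a = zero} {suc b} a≢b = refl
δ-≢ {a = suc a} {zero} a≢b = refl
δ-≢ {a = suc a} {suc b} a≢b = δ-≢ (a≢b ∘ cong suc)

sum-δ : ∀ {t} (a : Fin t) (g : Fin t → ℕ) → sum (λ b → δ a b ℕ.* g b) ≡ g a
sum-δ {suc t} zero g = begin
  g zero ℕ.+ 0 ℕ.+ sum (λ b → 0 ℕ.* g (suc b)) ≡⟨ cong₂ ℕ._+_ (ℕₚ.+-identityʳ (g zero)) (sum-zero t) ⟩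
  g zero ℕ.+ 0                                   ≡⟨ ℕₚ.+-identityʳ (g zero) ⟩
  g zero                                         ∎
  where open ≡-Reasoning
sum-δ {suc t} (suc a) g = sum-δ a (g ∘ suc)

sum-δ≡1 : ∀ {t} (a : Fin t) → sum (δ a) ≡ 1
sum-δ≡1 a = trans (sum-cong-≗ (λ b → sym (ℕₚ.*-identityʳ (δ a b)))) (sum-δ a (λ _ → 1))

less-< : ∀ {t} {a b : Fin t} → a Fin.< b → less a b ≡ 1
less-< {a = zero} {suc b} _ = refl
less-< {a = suc a} {suc b} (s≤s a<b) = less-< a<b

less-≮ : ∀ {t} {a b : Fin t} → ¬ a Fin.< b → less a b ≡ 0
less-≮ {a = zero} {zero} _ = refl
less-≮ {a = zero} {suc b} a≮b = ⊥-elim (a≮b (s≤s z≤n))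
less-≮ {a = suc a} {zero} _ = refl
less-≮ {a = suc a} {suc b} a≮b = less-≮ (a≮b ∘ s≤s)

less+less+δ≡1 : ∀ {t} (a b : Fin t) → less a b ℕ.+ less b a ℕ.+ δ a b ≡ 1
less+less+δ≡1 zero zero = refl
less+less+δ≡1 zero (suc b) = refl
less+less+δ≡1 (suc a) zero = refl
less+less+δ≡1 (suc a) (suc b) = less+less+δ≡1 a b

lessPairs : ℕ → ℕ
lessPairs t = sum (λ a → sum (less {t} a))

lessPairs+lessPairs+t≡t*t : ∀ t → lessPairs t ℕ.+ lessPairs t ℕ.+ t ≡ t ℕ.* t
lessPairs+lessPairs+t≡t*t t = sym (begin
  t ℕ.* t
    ≡⟨ trans (sum-const t _) (cong (t ℕ.*_) (trans (sum-const t 1) (ℕₚ.*-identityʳ t))) ⟨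
  sum {t} (λ _ → sum {t} (λ _ → 1))
    ≡⟨ sum-cong-≗ {t} (λ a → sum-cong-≗ (less+less+δ≡1 a)) ⟨
  sum (λ a → sum (λ b → less {t} a b ℕ.+ less b a ℕ.+ δ a b))
    ≡⟨ ∑∑-distrib-+ (λ a b → less {t} a b ℕ.+ less b a) δ ⟩
  sum (λ a → sum (λ b → less {t} a b ℕ.+ less b a)) ℕ.+ sum (λ a → sum (δ {t} a))
    ≡⟨ cong₂ ℕ._+_ (∑∑-distrib-+ less (λ a b → less {t} b a)) (sum-cong-≗ {t} sum-δ≡1) ⟩
  lessPairs t ℕ.+ sum (λ a → sum (λ b → less {t} b a)) ℕ.+ sum {t} (λ _ → 1)
    ≡⟨ cong₂ (λ p d → lessPairs t ℕ.+ p ℕ.+ d) (∑-comm (λ b a → less {t} a b)) (trans (sum-const t 1) (ℕₚ.*-identityʳ t)) ⟩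
  lessPairs t ℕ.+ lessPairs t ℕ.+ t ∎)
  where open ≡-Reasoning

defined : ∀ {t} → Maybe (Fin t) → ℕ
defined (just _) = 1
defined nothing = 0

hits : ∀ {t} → Maybe (Fin t) → Fin t → ℕ
hits (just b) a = δ b a
hits nothing a = 0

lessᴹ : ∀ {t} → Maybe (Fin t) → Maybe (Fin t) → ℕ
lessᴹ (just a) (just b) = less a b
lessᴹ _ _ = 0

defined≡sum-hits : ∀ {t} (m : Maybe (Fin t)) → defined m ≡ sum (hits m)
defined≡sum-hits (just b) = sym (sum-δ≡1 b)
defined≡sum-hits {t} nothing = sym (sum-zero t)

defined*defined : ∀ {t} (m₁ m₂ : Maybe (Fin t)) →
  defined m₁ ℕ.* defined m₂ ≡ lessᴹ m₁ m₂ ℕ.+ lessᴹ m₂ m₁ ℕ.+ sum (λ a → hits m₁ a ℕ.* hits m₂ a)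
defined*defined (just a) (just b) = sym (begin
  less a b ℕ.+ less b a ℕ.+ sum (λ c → δ a c ℕ.* δ b c) ≡⟨ cong (less a b ℕ.+ less b a ℕ.+_) (sum-δ a (δ b)) ⟩
  less a b ℕ.+ less b a ℕ.+ δ b a                        ≡⟨ cong (less a b ℕ.+ less b a ℕ.+_) (δ-sym b a) ⟩
  less a b ℕ.+ less b a ℕ.+ δ a b                        ≡⟨ less+less+δ≡1 a b ⟩
  1                                                       ∎)
  where open ≡-Reasoning
defined*defined {t} (just a) nothing = sym (trans (sum-cong-≗ (λ c → ℕₚ.*-zeroʳ (δ a c))) (sum-zero t))
defined*defined {t} nothing (just b) = sym (sum-zero t)
defined*defined {t} nothing nothing = sym (sum-zero t)

fibre : ∀ {n t} → PFun n t → Fin t → ℕ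
fibre f a = sum (λ x → hits (f x) a)

domSize : ∀ {n t} → PFun n t → ℕ
domSize f = sum (λ x → defined (f x))

increasingPairs : ∀ {n t} → PFun n t → ℕ
increasingPairs f = sum (λ x → sum (λ y → lessᴹ (f x) (f y)))

domSize≤n : ∀ {n t} (f : PFun n t) → domSize f ≤ n
domSize≤n {n} f = begin
  sum (λ x → defined (f x)) ≤⟨ sum-mono-≤ (λ x → defined≤1 (f x)) ⟩
  sum {n} (λ _ → 1)         ≡⟨ sum-const n 1 ⟩
  n ℕ.* 1                   ≡⟨ ℕₚ.*-identityʳ n ⟩
  n                         ∎
  where
  open ℕₚ.≤-Reasoning
  defined≤1 : ∀ {t} (m : Maybe (Fin t)) → defined m ≤ 1
  defined≤1 (just _) = ℕₚ.≤-refl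
  defined≤1 nothing = z≤n

domSize≡sum-fibre : ∀ {n t} (f : PFun n t) → domSize f ≡ sum (fibre f)
domSize≡sum-fibre f = trans (sum-cong-≗ (λ x → defined≡sum-hits (f x))) (∑-comm (λ x a → hits (f x) a))

domSize*domSize : ∀ {n t} (f : PFun n t) →
  domSize f ℕ.* domSize f ≡ increasingPairs f ℕ.+ increasingPairs f ℕ.+ sum (λ a → fibre f a ℕ.* fibre f a)
domSize*domSize {n} f = begin
  domSize f ℕ.* domSize f
    ≡⟨ sum-*-sum (λ x → defined (f x)) (λ y → defined (f y)) ⟩
  sum (λ x → sum (λ y → defined (f x) ℕ.* defined (f y)))
    ≡⟨ sum-cong-≗ (λ x → sum-cong-≗ (λ y → defined*defined (f x) (f y))) ⟩
  sum (λ x → sum (λ y → lessᴹ (f x) (f y) ℕ.+ lessᴹ (f y) (f x) ℕ.+ common x y))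
    ≡⟨ ∑∑-distrib-+ (λ x y → lessᴹ (f x) (f y) ℕ.+ lessᴹ (f y) (f x)) common ⟩
  sum (λ x → sum (λ y → lessᴹ (f x) (f y) ℕ.+ lessᴹ (f y) (f x))) ℕ.+ sum (λ x → sum (common x))
    ≡⟨ cong₂ ℕ._+_ (∑∑-distrib-+ (λ x y → lessᴹ (f x) (f y)) (λ x y → lessᴹ (f y) (f x))) commonValues ⟩
  increasingPairs f ℕ.+ sum (λ x → sum (λ y → lessᴹ (f y) (f x))) ℕ.+ sum (λ a → fibre f a ℕ.* fibre f a)
    ≡⟨ cong (λ s → increasingPairs f ℕ.+ s ℕ.+ sum (λ a → fibre f a ℕ.* fibre f a)) (∑-comm (λ x y → lessᴹ (f y) (f x))) ⟩
  increasingPairs f ℕ.+ increasingPairs f ℕ.+ sum (λ a → fibre f a ℕ.* fibre f a) ∎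
  where
  open ≡-Reasoning
  common : Fin n → Fin n → ℕ
  common x y = sum (λ a → hits (f x) a ℕ.* hits (f y) a)
  commonValues : sum (λ x → sum (common x)) ≡ sum (λ a → fibre f a ℕ.* fibre f a)
  commonValues = begin
    sum (λ x → sum (λ y → sum (λ a → hits (f x) a ℕ.* hits (f y) a)))
      ≡⟨ sum-cong-≗ (λ x → ∑-comm (λ y a → hits (f x) a ℕ.* hits (f y) a)) ⟩
    sum (λ x → sum (λ a → sum (λ y → hits (f x) a ℕ.* hits (f y) a)))
      ≡⟨ ∑-comm (λ x a → sum (λ y → hits (f x) a ℕ.* hits (f y) a)) ⟩
    sum (λ a → sum (λ x → sum (λ y → hits (f x) a ℕ.* hits (f y) a)))
      ≡⟨ sum-cong-≗ (λ a → sum-*-sum (λ x → hits (f x) a) (λ y → hits (f y) a)) ⟨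
    sum (λ a → fibre f a ℕ.* fibre f a) ∎

increasingPairs-bound : ∀ {n k} (f : PFun n (suc k)) →
  suc k ℕ.* (increasingPairs f ℕ.+ increasingPairs f) ≤ k ℕ.* n ℕ.* domSize f
increasingPairs-bound {n} {k} f = begin
  suc k ℕ.* (I ℕ.+ I)  ≤⟨ ℕₚ.+-cancelʳ-≤ (D ℕ.* D) _ _ withSquare ⟩
  k ℕ.* (D ℕ.* D)      ≤⟨ ℕₚ.*-monoʳ-≤ k (ℕₚ.*-monoˡ-≤ D (domSize≤n f)) ⟩
  k ℕ.* (n ℕ.* D)      ≡⟨ ℕₚ.*-assoc k n D ⟨
  k ℕ.* n ℕ.* D        ∎
  where
  open ℕₚ.≤-Reasoning
  I D Q : ℕ
  I = increasingPairs f
  D = domSize f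
  Q = sum (λ a → fibre f a ℕ.* fibre f a)
  withSquare : suc k ℕ.* (I ℕ.+ I) ℕ.+ D ℕ.* D ≤ k ℕ.* (D ℕ.* D) ℕ.+ D ℕ.* D
  withSquare = begin
    suc k ℕ.* (I ℕ.+ I) ℕ.+ D ℕ.* D     ≤⟨ ℕₚ.+-monoʳ-≤ (suc k ℕ.* (I ℕ.+ I))
                                              (subst (λ d → d ℕ.* d ≤ suc k ℕ.* Q) (sym (domSize≡sum-fibre f)) (cauchy-schwarz (suc k) (fibre f))) ⟩
    suc k ℕ.* (I ℕ.+ I) ℕ.+ suc k ℕ.* Q ≡⟨ ℕₚ.*-distribˡ-+ (suc k) (I ℕ.+ I) Q ⟨
    suc k ℕ.* (I ℕ.+ I ℕ.+ Q)           ≡⟨ cong (suc k ℕ.*_) (domSize*domSize f) ⟨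
    suc k ℕ.* (D ℕ.* D)                 ≡⟨ ℕₚ.+-comm (D ℕ.* D) (k ℕ.* (D ℕ.* D)) ⟩
    k ℕ.* (D ℕ.* D) ℕ.+ D ℕ.* D         ∎

-- Total separation and total load of a weighting
sepW≡ : ∀ {n t} (f : PFun n t) q x y → sepW f q x y ≡ q * fromℕ (lessᴹ (f x) (f y))
sepW≡ f q x y with f x | f y
... | just a | just b with a Fin.<? b
...   | yes a<b = trans (sym (ℚₚ.*-identityʳ q)) (cong (λ l → q * fromℕ l) (sym (less-< a<b)))
...   | no a≮b = trans (sym (ℚₚ.*-zeroʳ q)) (cong (λ l → q * fromℕ l) (sym (less-≮ a≮b)))
sepW≡ f q x y | just a | nothing = sym (ℚₚ.*-zeroʳ q)
sepW≡ f q x y | nothing | _ = sym (ℚₚ.*-zeroʳ q)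

loadW≡ : ∀ {n t} (f : PFun n t) q x → loadW f q x ≡ q * fromℕ (defined (f x))
loadW≡ f q x with f x
... | just _ = sym (ℚₚ.*-identityʳ q)
... | nothing = sym (ℚₚ.*-zeroʳ q)

totalSeparation : ∀ {n t} → Weighting n t → ℚ
totalSeparation w = sumℚ (λ x → sumℚ (λ y → sepSum w x y))

totalLoad : ∀ {n t} → Weighting n t → ℚ
totalLoad w = sumℚ (load w)

totalSeparation-[] : ∀ {n t} → totalSeparation {n} {t} [] ≡ 0ℚ
totalSeparation-[] {n} = trans (ℚ-Sum.sum-cong-≗ {n} (λ _ → ℚ-Sum.sum-replicate-zero n)) (ℚ-Sum.sum-replicate-zero n)

totalLoad-[] : ∀ {n t} → totalLoad {n} {t} [] ≡ 0ℚ
totalLoad-[] {n} = ℚ-Sum.sum-replicate-zero n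

totalSeparation-∷ : ∀ {n t} (f : PFun n t) q w →
  totalSeparation ((f , q) ∷ w) ≡ q * fromℕ (increasingPairs f) + totalSeparation w
totalSeparation-∷ f q w = begin
  sumℚ (λ x → sumℚ (λ y → sepW f q x y + sepSum w x y))
    ≡⟨ ℚ-Sum.sum-cong-≗ (λ x → ℚ-Sum.∑-distrib-+ (λ y → sepW f q x y) (λ y → sepSum w x y)) ⟩
  sumℚ (λ x → sumℚ (λ y → sepW f q x y) + sumℚ (λ y → sepSum w x y))
    ≡⟨ ℚ-Sum.∑-distrib-+ (λ x → sumℚ (λ y → sepW f q x y)) (λ x → sumℚ (λ y → sepSum w x y)) ⟩
  sumℚ (λ x → sumℚ (λ y → sepW f q x y)) + totalSeparation w
    ≡⟨ cong (_+ totalSeparation w) (ℚ-Sum.sum-cong-≗ (λ x → ℚ-Sum.sum-cong-≗ (sepW≡ f q x))) ⟩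
  sumℚ (λ x → sumℚ (λ y → q * fromℕ (lessᴹ (f x) (f y)))) + totalSeparation w
    ≡⟨ cong (_+ totalSeparation w) (trans (ℚ-Sum.sum-cong-≗ (λ x → sumℚ-*-fromℕ q (λ y → lessᴹ (f x) (f y))))
                                          (sumℚ-*-fromℕ q (λ x → sum (λ y → lessᴹ (f x) (f y))))) ⟩
  q * fromℕ (increasingPairs f) + totalSeparation w ∎
  where open ≡-Reasoning

totalLoad-∷ : ∀ {n t} (f : PFun n t) q w → totalLoad ((f , q) ∷ w) ≡ q * fromℕ (domSize f) + totalLoad w
totalLoad-∷ f q w = trans (ℚ-Sum.∑-distrib-+ (loadW f q) (load w))
  (cong (_+ totalLoad w) (trans (ℚ-Sum.sum-cong-≗ (loadW≡ f q)) (sumℚ-*-fromℕ q (λ x → defined (f x)))))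

totalSeparation-bound : ∀ {n k} (w : Weighting n (suc k)) → All (λ p → 0ℚ ℚ.≤ proj₂ p) w →
  fromℕ (suc k) * (totalSeparation w + totalSeparation w) ℚ.≤ fromℕ (k ℕ.* n) * totalLoad w
totalSeparation-bound {n} {k} [] [] = ℚₚ.≤-reflexive (begin
  t * (totalSeparation {n} {suc k} [] + totalSeparation {n} {suc k} [])
    ≡⟨ cong (λ s → t * (s + s)) (totalSeparation-[] {n} {suc k}) ⟩
  t * 0ℚ                    ≡⟨ ℚₚ.*-zeroʳ t ⟩
  0ℚ                        ≡⟨ ℚₚ.*-zeroʳ c ⟨
  c * 0ℚ                    ≡⟨ cong (c *_) (totalLoad-[] {n} {suc k}) ⟨
  c * totalLoad {n} {suc k} [] ∎)
  where
  open ≡-Reasoning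
  t c : ℚ
  t = fromℕ (suc k)
  c = fromℕ (k ℕ.* n)
totalSeparation-bound {n} {k} ((f , q) ∷ w) (q≥0 ∷ w≥0) = begin
  t * (totalSeparation ((f , q) ∷ w) + totalSeparation ((f , q) ∷ w))
    ≡⟨ cong (λ s → t * (s + s)) (totalSeparation-∷ f q w) ⟩
  t * ((q * I + S) + (q * I + S))
    ≡⟨ solve 4 (λ t q i s → t :* ((q :* i :+ s) :+ (q :* i :+ s)) := q :* (t :* (i :+ i)) :+ t :* (s :+ s)) refl t q I S ⟩
  q * (t * (I + I)) + t * (S + S)
    ≡⟨ cong (λ z → q * z + t * (S + S)) (trans (fromℕ-* (suc k) (I₀ ℕ.+ I₀)) (cong (t *_) (fromℕ-+ I₀ I₀))) ⟨
  q * fromℕ (suc k ℕ.* (I₀ ℕ.+ I₀)) + t * (S + S)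
    ≤⟨ ℚₚ.+-mono-≤ (ℚₚ.*-monoˡ-≤-nonNeg q {{ℚ.nonNegative q≥0}} (fromℕ-mono-≤ (increasingPairs-bound f)))
                   (totalSeparation-bound w w≥0) ⟩
  q * fromℕ (k ℕ.* n ℕ.* domSize f) + c * totalLoad w
    ≡⟨ cong (λ z → q * z + c * totalLoad w) (fromℕ-* (k ℕ.* n) (domSize f)) ⟩
  q * (c * fromℕ (domSize f)) + c * totalLoad w
    ≡⟨ solve 4 (λ q c d l → q :* (c :* d) :+ c :* l := c :* (q :* d :+ l)) refl q c (fromℕ (domSize f)) (totalLoad w) ⟩
  c * (q * fromℕ (domSize f) + totalLoad w)
    ≡⟨ cong (c *_) (totalLoad-∷ f q w) ⟨
  c * totalLoad ((f , q) ∷ w) ∎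
  where
  open ℚₚ.≤-Reasoning
  open ℚSolver.+-*-Solver
  t c : ℚ
  t = fromℕ (suc k)
  c = fromℕ (k ℕ.* n)
  I₀ : ℕ
  I₀ = increasingPairs f
  I S : ℚ
  I = fromℕ I₀
  S = totalSeparation w

sepSum-nonNeg : ∀ {n t} (w : Weighting n t) → All (λ p → 0ℚ ℚ.≤ proj₂ p) w → ∀ x y → 0ℚ ℚ.≤ sepSum w x y
sepSum-nonNeg [] [] x y = ℚₚ.≤-refl
sepSum-nonNeg ((f , q) ∷ w) (q≥0 ∷ w≥0) x y = ℚₚ.+-mono-≤ {0ℚ} {_} {0ℚ} sepW≥0 (sepSum-nonNeg w w≥0 x y)
  where
  sepW≥0 : 0ℚ ℚ.≤ sepW f q x y
  sepW≥0 = subst₂ ℚ._≤_ (ℚₚ.*-zeroʳ q) (sym (sepW≡ f q x y))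
    (ℚₚ.*-monoˡ-≤-nonNeg q {{ℚ.nonNegative q≥0}} (fromℕ-nonNeg (lessᴹ (f x) (f y))))

-- All functions into a chain
sumᴸ : ∀ {A : Set} → List A → (A → ℕ) → ℕ
sumᴸ [] h = 0
sumᴸ (a ∷ as) h = h a ℕ.+ sumᴸ as h

sumᴸ-++ : ∀ {A : Set} (as bs : List A) h → sumᴸ (as ++ bs) h ≡ sumᴸ as h ℕ.+ sumᴸ bs h
sumᴸ-++ [] bs h = refl
sumᴸ-++ (a ∷ as) bs h = trans (cong (h a ℕ.+_) (sumᴸ-++ as bs h)) (sym (ℕₚ.+-assoc (h a) _ _))

sumᴸ-map : ∀ {A B : Set} (φ : A → B) (as : List A) h → sumᴸ (map φ as) h ≡ sumᴸ as (h ∘ φ)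
sumᴸ-map φ [] h = refl
sumᴸ-map φ (a ∷ as) h = cong (h (φ a) ℕ.+_) (sumᴸ-map φ as h)

sumᴸ-const : ∀ {A : Set} (as : List A) k → sumᴸ as (λ _ → k) ≡ k ℕ.* length as
sumᴸ-const [] k = sym (ℕₚ.*-zeroʳ k)
sumᴸ-const (a ∷ as) k = trans (cong (k ℕ.+_) (sumᴸ-const as k)) (sym (ℕₚ.*-suc k (length as)))

⋃ : ∀ {A : Set} {m} → (Fin m → List A) → List A
⋃ {m = zero} G = []
⋃ {m = suc m} G = G zero ++ ⋃ (G ∘ suc)

sumᴸ-⋃ : ∀ {A : Set} {m} (G : Fin m → List A) h → sumᴸ (⋃ G) h ≡ sum (λ i → sumᴸ (G i) h)
sumᴸ-⋃ {m = zero} G h = refl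
sumᴸ-⋃ {m = suc m} G h = trans (sumᴸ-++ (G zero) (⋃ (G ∘ suc)) h) (cong (sumᴸ (G zero) h ℕ.+_) (sumᴸ-⋃ (G ∘ suc) h))

functions : ∀ t n → List (Fin n → Fin t)
functions t zero = (λ ()) ∷ []
functions t (suc n) = ⋃ (λ a → map (a Vector.∷_) (functions t n))

sumᴸ-functions : ∀ t n (h : (Fin (suc n) → Fin t) → ℕ) →
  sumᴸ (functions t (suc n)) h ≡ sum (λ a → sumᴸ (functions t n) (λ g → h (a Vector.∷ g)))
sumᴸ-functions t n h = trans (sumᴸ-⋃ (λ a → map (a Vector.∷_) (functions t n)) h)
  (sum-cong-≗ (λ a → sumᴸ-map (a Vector.∷_) (functions t n) h))

length-functions : ∀ t n → length (functions t n) ≡ t ^ n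
length-functions t zero = refl
length-functions t (suc n) = begin
  length (functions t (suc n))                   ≡⟨ trans (sumᴸ-const (functions t (suc n)) 1) (ℕₚ.*-identityˡ _) ⟨
  sumᴸ (functions t (suc n)) (λ _ → 1)          ≡⟨ sumᴸ-functions t n (λ _ → 1) ⟩
  sum {t} (λ _ → sumᴸ (functions t n) (λ _ → 1)) ≡⟨ sum-const t _ ⟩
  t ℕ.* sumᴸ (functions t n) (λ _ → 1)          ≡⟨ cong (t ℕ.*_) (trans (sumᴸ-const (functions t n) 1) (ℕₚ.*-identityˡ _)) ⟩
  t ℕ.* length (functions t n)                  ≡⟨ cong (t ℕ.*_) (length-functions t n) ⟩
  t ℕ.* t ^ n                                   ∎
  where open ≡-Reasoning

sumᴸ-functions-at : ∀ t n (x : Fin n) (h : Fin t → ℕ) →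
  t ℕ.* sumᴸ (functions t n) (λ g → h (g x)) ≡ t ^ n ℕ.* sum h
sumᴸ-functions-at t (suc n) zero h = begin
  t ℕ.* sumᴸ (functions t (suc n)) (λ g → h (g zero))    ≡⟨ cong (t ℕ.*_) (sumᴸ-functions t n (λ g → h (g zero))) ⟩
  t ℕ.* sum (λ a → sumᴸ (functions t n) (λ _ → h a))     ≡⟨ cong (t ℕ.*_) (sum-cong-≗ (λ a → sumᴸ-const (functions t n) (h a))) ⟩
  t ℕ.* sum (λ a → h a ℕ.* length (functions t n))       ≡⟨ cong (t ℕ.*_) (ℕ-Sum.*-distribʳ-sum (length (functions t n)) h) ⟨
  t ℕ.* (sum h ℕ.* length (functions t n))               ≡⟨ cong (λ l → t ℕ.* (sum h ℕ.* l)) (length-functions t n) ⟩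
  t ℕ.* (sum h ℕ.* t ^ n)                                ≡⟨ solve 3 (λ t s p → t :* (s :* p) := t :* p :* s) refl t (sum h) (t ^ n) ⟩
  t ^ suc n ℕ.* sum h                                    ∎
  where
  open ≡-Reasoning
  open ℕSolver.+-*-Solver
sumᴸ-functions-at t (suc n) (suc x) h = begin
  t ℕ.* sumᴸ (functions t (suc n)) (λ g → h (g (suc x)))  ≡⟨ cong (t ℕ.*_) (sumᴸ-functions t n (λ g → h (g (suc x)))) ⟩
  t ℕ.* sum {t} (λ _ → sumᴸ (functions t n) (λ g → h (g x))) ≡⟨ cong (t ℕ.*_) (sum-const t _) ⟩
  t ℕ.* (t ℕ.* sumᴸ (functions t n) (λ g → h (g x)))      ≡⟨ cong (t ℕ.*_) (sumᴸ-functions-at t n x h) ⟩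
  t ℕ.* (t ^ n ℕ.* sum h)                                 ≡⟨ ℕₚ.*-assoc t (t ^ n) (sum h) ⟨
  t ^ suc n ℕ.* sum h                                     ∎
  where open ≡-Reasoning

sumᴸ-functions-at₂ : ∀ t n {x y : Fin n} → ¬ x ≡ y → (H : Fin t → Fin t → ℕ) →
  t ℕ.* (t ℕ.* sumᴸ (functions t n) (λ g → H (g x) (g y))) ≡ t ^ n ℕ.* sum (λ a → sum (H a))
sumᴸ-functions-at₂ t (suc n) {zero} {zero} x≢y H = ⊥-elim (x≢y refl)
sumᴸ-functions-at₂ t (suc n) {zero} {suc y} x≢y H = begin
  t ℕ.* (t ℕ.* sumᴸ (functions t (suc n)) (λ g → H (g zero) (g (suc y))))
    ≡⟨ cong (λ s → t ℕ.* (t ℕ.* s)) (sumᴸ-functions t n (λ g → H (g zero) (g (suc y)))) ⟩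
  t ℕ.* (t ℕ.* sum (λ a → sumᴸ (functions t n) (λ g → H a (g y))))
    ≡⟨ cong (t ℕ.*_) (ℕ-Sum.*-distribˡ-sum t (λ a → sumᴸ (functions t n) (λ g → H a (g y)))) ⟩
  t ℕ.* sum (λ a → t ℕ.* sumᴸ (functions t n) (λ g → H a (g y)))
    ≡⟨ cong (t ℕ.*_) (sum-cong-≗ (λ a → sumᴸ-functions-at t n y (H a))) ⟩
  t ℕ.* sum (λ a → t ^ n ℕ.* sum (H a))
    ≡⟨ cong (t ℕ.*_) (ℕ-Sum.*-distribˡ-sum (t ^ n) (λ a → sum (H a))) ⟨
  t ℕ.* (t ^ n ℕ.* sum (λ a → sum (H a)))
    ≡⟨ ℕₚ.*-assoc t (t ^ n) _ ⟨
  t ^ suc n ℕ.* sum (λ a → sum (H a)) ∎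
  where open ≡-Reasoning
sumᴸ-functions-at₂ t (suc n) {suc x} {zero} x≢y H = begin
  t ℕ.* (t ℕ.* sumᴸ (functions t (suc n)) (λ g → H (g (suc x)) (g zero)))
    ≡⟨ cong (λ s → t ℕ.* (t ℕ.* s)) (sumᴸ-functions t n (λ g → H (g (suc x)) (g zero))) ⟩
  t ℕ.* (t ℕ.* sum (λ b → sumᴸ (functions t n) (λ g → H (g x) b)))
    ≡⟨ cong (t ℕ.*_) (ℕ-Sum.*-distribˡ-sum t (λ b → sumᴸ (functions t n) (λ g → H (g x) b))) ⟩
  t ℕ.* sum (λ b → t ℕ.* sumᴸ (functions t n) (λ g → H (g x) b))
    ≡⟨ cong (t ℕ.*_) (sum-cong-≗ (λ b → sumᴸ-functions-at t n x (λ a → H a b))) ⟩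
  t ℕ.* sum (λ b → t ^ n ℕ.* sum (λ a → H a b))
    ≡⟨ cong (t ℕ.*_) (ℕ-Sum.*-distribˡ-sum (t ^ n) (λ b → sum (λ a → H a b))) ⟨
  t ℕ.* (t ^ n ℕ.* sum (λ b → sum (λ a → H a b)))
    ≡⟨ cong (λ s → t ℕ.* (t ^ n ℕ.* s)) (∑-comm (λ b a → H a b)) ⟩
  t ℕ.* (t ^ n ℕ.* sum (λ a → sum (H a)))
    ≡⟨ ℕₚ.*-assoc t (t ^ n) _ ⟨
  t ^ suc n ℕ.* sum (λ a → sum (H a)) ∎
  where open ≡-Reasoning
sumᴸ-functions-at₂ t (suc n) {suc x} {suc y} x≢y H = begin
  t ℕ.* (t ℕ.* sumᴸ (functions t (suc n)) (λ g → H (g (suc x)) (g (suc y))))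
    ≡⟨ cong (λ s → t ℕ.* (t ℕ.* s)) (trans (sumᴸ-functions t n (λ g → H (g (suc x)) (g (suc y)))) (sum-const t _)) ⟩
  t ℕ.* (t ℕ.* (t ℕ.* sumᴸ (functions t n) (λ g → H (g x) (g y))))
    ≡⟨ cong (t ℕ.*_) (sumᴸ-functions-at₂ t n (x≢y ∘ cong suc) H) ⟩
  t ℕ.* (t ^ n ℕ.* sum (λ a → sum (H a)))
    ≡⟨ ℕₚ.*-assoc t (t ^ n) _ ⟨
  t ^ suc n ℕ.* sum (λ a → sum (H a)) ∎
  where open ≡-Reasoning

increasingCount : ∀ t n → Fin n → Fin n → ℕ
increasingCount t n x y = sumᴸ (functions t n) (λ g → less (g x) (g y))

increasingCount-≡ : ∀ k n {x y : Fin n} → ¬ x ≡ y →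
  suc k ℕ.* (increasingCount (suc k) n x y ℕ.+ increasingCount (suc k) n x y) ≡ suc k ^ n ℕ.* k
increasingCount-≡ k n {x} {y} x≢y = ℕₚ.+-cancelʳ-≡ (t ^ n) _ _ (trans (ℕₚ.*-cancelˡ-≡ _ _ t (begin
  t ℕ.* (t ℕ.* (C ℕ.+ C) ℕ.+ t ^ n)
    ≡⟨ solve 3 (λ t c p → t :* (t :* (c :+ c) :+ p) := t :* (t :* c) :+ t :* (t :* c) :+ p :* t) refl t C (t ^ n) ⟩
  t ℕ.* (t ℕ.* C) ℕ.+ t ℕ.* (t ℕ.* C) ℕ.+ t ^ n ℕ.* t
    ≡⟨ cong (λ s → s ℕ.+ s ℕ.+ t ^ n ℕ.* t) (sumᴸ-functions-at₂ t n x≢y less) ⟩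
  t ^ n ℕ.* P ℕ.+ t ^ n ℕ.* P ℕ.+ t ^ n ℕ.* t
    ≡⟨ solve 3 (λ p q t → p :* q :+ p :* q :+ p :* t := p :* (q :+ q :+ t)) refl (t ^ n) P t ⟩
  t ^ n ℕ.* (P ℕ.+ P ℕ.+ t)
    ≡⟨ cong (t ^ n ℕ.*_) (lessPairs+lessPairs+t≡t*t t) ⟩
  t ^ n ℕ.* (t ℕ.* t)
    ≡⟨ solve 2 (λ p t → p :* (t :* t) := t :* (p :* t)) refl (t ^ n) t ⟩
  t ℕ.* (t ^ n ℕ.* t) ∎)) (trans (ℕₚ.*-suc (t ^ n) k) (ℕₚ.+-comm (t ^ n) (t ^ n ℕ.* k))))
  where
  open ≡-Reasoning
  open ℕSolver.+-*-Solver
  t C P : ℕ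
  t = suc k
  C = increasingCount t n x y
  P = lessPairs t

-- The antichain
uniformWeighting : ∀ {n t} → ℚ → List (Fin n → Fin t) → Weighting n t
uniformWeighting c = map (λ g → (just ∘ g , c))

sepSum-uniform : ∀ {n t} c (gs : List (Fin n → Fin t)) x y →
  sepSum (uniformWeighting c gs) x y ≡ c * fromℕ (sumᴸ gs (λ g → less (g x) (g y)))
sepSum-uniform c [] x y = sym (ℚₚ.*-zeroʳ c)
sepSum-uniform c (g ∷ gs) x y = begin
  sepW (just ∘ g) c x y + sepSum (uniformWeighting c gs) x y ≡⟨ cong₂ _+_ (sepW≡ (just ∘ g) c x y) (sepSum-uniform c gs x y) ⟩
  c * fromℕ l + c * fromℕ ls                                 ≡⟨ ℚₚ.*-distribˡ-+ c (fromℕ l) (fromℕ ls) ⟨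
  c * (fromℕ l + fromℕ ls)                                   ≡⟨ cong (c *_) (fromℕ-+ l ls) ⟨
  c * fromℕ (l ℕ.+ ls)                                       ∎
  where
  open ≡-Reasoning
  l ls : ℕ
  l = less (g x) (g y)
  ls = sumᴸ gs (λ g → less (g x) (g y))

load-uniform : ∀ {n t} c (gs : List (Fin n → Fin t)) x → load (uniformWeighting c gs) x ≡ c * fromℕ (length gs)
load-uniform c [] x = sym (ℚₚ.*-zeroʳ c)
load-uniform c (g ∷ gs) x = begin
  loadW (just ∘ g) c x + load (uniformWeighting c gs) x ≡⟨ cong (c +_) (load-uniform c gs x) ⟩
  c + c * fromℕ (length gs)                             ≡⟨ cong (_+ c * fromℕ (length gs)) (ℚₚ.*-identityʳ c) ⟨
  c * 1ℚ + c * fromℕ (length gs)                        ≡⟨ ℚₚ.*-distribˡ-+ c 1ℚ (fromℕ (length gs)) ⟨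
  c * fromℕ (suc (length gs))                           ∎
  where open ≡-Reasoning

antichain-monotone : ∀ {n t} (f : PFun n t) → Monotone (Antichain n) f
antichain-monotone f x .x a b refl fx≡a fx≡b = Finₚ.≤-reflexive (Maybeₚ.just-injective (trans (sym fx≡a) fx≡b))

uniform-valid : ∀ {n t} c → 0ℚ ℚ.≤ c → (gs : List (Fin n → Fin t)) → ValidWeighting (Antichain n) (uniformWeighting c gs)
uniform-valid c c≥0 [] = []
uniform-valid c c≥0 (g ∷ gs) = (antichain-monotone (just ∘ g) , c≥0) ∷ uniform-valid c c≥0 gs

uniform-total : ∀ {n t} c (gs : List (Fin n → Fin t)) → All (λ p → Total (proj₁ p)) (uniformWeighting c gs)
uniform-total c [] = []
uniform-total c (g ∷ gs) = (λ x → g x , refl) ∷ uniform-total c gs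

antichain-fdim≤ : ∀ t (t≥2 : 2 ≤ t) n → FDimAtMost t (Antichain n) (limitValue t t≥2)
antichain-fdim≤ (suc zero) (s≤s ()) n
antichain-fdim≤ (suc (suc j)) t≥2 n = w , ((uniform-valid c c≥0 fs , separates) , uniform-total c fs) , load≤
  where
  k t M : ℕ
  k = suc j
  t = suc k
  M = t ^ n ℕ.* k
  instance
    M≢0 : ℕ.NonZero M
    M≢0 = ℕₚ.m*n≢0 (t ^ n) k {{ℕₚ.m^n≢0 t n}}
  c : ℚ
  c = ℤ.+ (2 ℕ.* t) / M
  fs : List (Fin n → Fin t)
  fs = functions t n
  w : Weighting n t
  w = uniformWeighting c fs

  c≥0 : 0ℚ ℚ.≤ c
  c≥0 = ℚₚ.nonNegative⁻¹ c {{ℚₚ.normalize-nonNeg (2 ℕ.* t) M}}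

  separates : ∀ x y → ¬ y ≡ x → 1ℚ ℚ.≤ sepSum w x y
  separates x y y≢x = subst (1ℚ ℚ.≤_) (sym (sepSum-uniform c fs x y))
    (ℚₚ.*-cancelʳ-≤-pos (fromℕ (2 ℕ.* t)) {{ℚ.positive (fromℕ-pos (k ℕ.+ 1 ℕ.* t))}} (ℚₚ.≤-reflexive (begin
      1ℚ * fromℕ (2 ℕ.* t)       ≡⟨ ℚₚ.*-identityˡ _ ⟩
      fromℕ (2 ℕ.* t)            ≡⟨ a/d*d≡a (2 ℕ.* t) M ⟨
      c * fromℕ M                ≡⟨ cong (λ m → c * fromℕ m) M≡C*2t ⟩
      c * fromℕ (C ℕ.* (2 ℕ.* t)) ≡⟨ cong (c *_) (fromℕ-* C (2 ℕ.* t)) ⟩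
      c * (fromℕ C * fromℕ (2 ℕ.* t)) ≡⟨ ℚₚ.*-assoc c (fromℕ C) _ ⟨
      c * fromℕ C * fromℕ (2 ℕ.* t) ∎)))
    where
    open ≡-Reasoning
    open ℕSolver.+-*-Solver
    C : ℕ
    C = increasingCount t n x y
    M≡C*2t : M ≡ C ℕ.* (2 ℕ.* t)
    M≡C*2t = trans (sym (increasingCount-≡ k n (y≢x ∘ sym)))
      (solve 2 (λ t c → t :* (c :+ c) := c :* (con 2 :* t)) refl t C)

  load≤ : ∀ x → load w x ℚ.≤ limitValue t t≥2
  load≤ x = subst (ℚ._≤ limitValue t t≥2) (sym (load-uniform c fs x))
    (ℚₚ.*-cancelʳ-≤-pos (fromℕ k) {{ℚ.positive (fromℕ-pos j)}} (ℚₚ.≤-reflexive (begin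
      c * fromℕ (length fs) * fromℕ k   ≡⟨ cong (λ l → c * fromℕ l * fromℕ k) (length-functions t n) ⟩
      c * fromℕ (t ^ n) * fromℕ k       ≡⟨ ℚₚ.*-assoc c _ _ ⟩
      c * (fromℕ (t ^ n) * fromℕ k)     ≡⟨ cong (c *_) (fromℕ-* (t ^ n) k) ⟨
      c * fromℕ M                       ≡⟨ a/d*d≡a (2 ℕ.* t) M ⟩
      fromℕ (2 ℕ.* t)                   ≡⟨ a/d*d≡a (2 ℕ.* t) k ⟨
      limitValue t t≥2 * fromℕ k        ∎)))
    where open ≡-Reasoning

sum-1∸δ : ∀ m (x : Fin (suc m)) → sum (λ y → 1 ℕ.∸ δ x y) ≡ m
sum-1∸δ m zero = trans (sum-const m 1) (ℕₚ.*-identityʳ m)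
sum-1∸δ (suc m) (suc x) = cong suc (sum-1∸δ m x)

antichain-totalSeparation : ∀ {m t} (w : Weighting (suc m) t) → FracLocalRealiser t (Antichain (suc m)) w →
  fromℕ (suc m ℕ.* m) ℚ.≤ totalSeparation w
antichain-totalSeparation {m} w (valid , separates) = begin
  fromℕ (suc m ℕ.* m)
    ≡⟨ cong fromℕ (trans (sum-cong-≗ (sum-1∸δ m)) (sum-const (suc m) m)) ⟨
  fromℕ (sum {suc m} (λ x → sum (λ y → 1 ℕ.∸ δ x y)))
    ≡⟨ trans (fromℕ-sum {suc m} (λ x → sum (λ y → 1 ℕ.∸ δ x y))) (ℚ-Sum.sum-cong-≗ {suc m} (λ x → fromℕ-sum (λ y → 1 ℕ.∸ δ x y))) ⟩
  sumℚ {suc m} (λ x → sumℚ (λ y → fromℕ (1 ℕ.∸ δ x y)))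
    ≤⟨ sumℚ-mono-≤ (λ x → sumℚ-mono-≤ (offDiagonal≤sepSum x)) ⟩
  totalSeparation w ∎
  where
  open ℚₚ.≤-Reasoning
  offDiagonal≤sepSum : ∀ x y → fromℕ (1 ℕ.∸ δ x y) ℚ.≤ sepSum w x y
  offDiagonal≤sepSum x y with x Fin.≟ y
  ... | yes refl rewrite δ-refl x = sepSum-nonNeg w (All.map proj₂ valid) x x
  ... | no x≢y rewrite δ-≢ x≢y = separates x y (x≢y ∘ sym)

antichain-load-lowerBound : ∀ {m k} (w : Weighting (suc m) (suc k)) → FracLocalRealiser (suc k) (Antichain (suc m)) w →
  ∃ λ x → fromℕ (suc k) * (fromℕ m + fromℕ m) ℚ.≤ fromℕ k * fromℕ (suc m) * load w x
antichain-load-lowerBound {m} {k} w realiser@(valid , _) = x , ℚₚ.*-cancelʳ-≤-pos n {{ℚ.positive (fromℕ-pos m)}} (begin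
  t * (fromℕ m + fromℕ m) * n
    ≡⟨ solve 3 (λ t m n → t :* (m :+ m) :* n := t :* (n :* m :+ n :* m)) refl t (fromℕ m) n ⟩
  t * (n * fromℕ m + n * fromℕ m)
    ≡⟨ cong (λ z → t * (z + z)) (fromℕ-* (suc m) m) ⟨
  t * (fromℕ (suc m ℕ.* m) + fromℕ (suc m ℕ.* m))
    ≤⟨ ℚₚ.*-monoˡ-≤-nonNeg t {{ℚ.nonNegative (fromℕ-nonNeg (suc k))}} (ℚₚ.+-mono-≤ separation≥ separation≥) ⟩
  t * (totalSeparation w + totalSeparation w)
    ≤⟨ totalSeparation-bound w (All.map proj₂ valid) ⟩
  fromℕ (k ℕ.* suc m) * totalLoad w
    ≤⟨ ℚₚ.*-monoˡ-≤-nonNeg (fromℕ (k ℕ.* suc m)) {{ℚ.nonNegative (fromℕ-nonNeg (k ℕ.* suc m))}} totalLoad≤ ⟩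
  fromℕ (k ℕ.* suc m) * (n * load w x)
    ≡⟨ cong (_* (n * load w x)) (fromℕ-* k (suc m)) ⟩
  fromℕ k * n * (n * load w x)
    ≡⟨ solve 3 (λ k n l → k :* n :* (n :* l) := k :* n :* l :* n) refl (fromℕ k) n (load w x) ⟩
  fromℕ k * n * load w x * n ∎)
  where
  open ℚₚ.≤-Reasoning
  open ℚSolver.+-*-Solver
  t n : ℚ
  t = fromℕ (suc k)
  n = fromℕ (suc m)
  separation≥ : fromℕ (suc m ℕ.* m) ℚ.≤ totalSeparation w
  separation≥ = antichain-totalSeparation w realiser
  x : Fin (suc m)
  x = proj₁ (sumℚ≤size*max (load w))
  totalLoad≤ : totalLoad w ℚ.≤ n * load w x
  totalLoad≤ = proj₂ (sumℚ≤size*max (load w))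

limitValue≤2t : ∀ t (t≥2 : 2 ≤ t) → limitValue t t≥2 ℚ.≤ fromℕ (2 ℕ.* t)
limitValue≤2t (suc zero) (s≤s ())
limitValue≤2t (suc (suc j)) _ = a/d≤a (2 ℕ.* suc (suc j)) (suc j)

antichain-fldim≥ : ∀ t (t≥2 : 2 ≤ t) m ε → limitValue t t≥2 ℚ.≤ ε * fromℕ (suc m) →
  FLDimAtLeast t (Antichain (suc m)) (limitValue t t≥2 - ε)
antichain-fldim≥ (suc zero) (s≤s ()) m ε
antichain-fldim≥ (suc (suc j)) t≥2 m ε L≤ε*n w realiser =
  x , ℚₚ.*-cancelʳ-≤-pos (K * N) {{ℚₚ.pos*pos⇒pos K {{ℚ.positive (fromℕ-pos j)}} N {{ℚ.positive (fromℕ-pos m)}}}} (begin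
  (L - ε) * (K * N)
    ≡⟨ solve 4 (λ L ε K M → (L :- ε) :* (K :* (con 1ℚ :+ M)) := L :* K :* M :+ (L :* K :- ε :* (con 1ℚ :+ M) :* K)) refl L ε K M ⟩
  L * K * M + (L * K - ε * N * K)
    ≡⟨ cong (λ a → a * M + (L * K - ε * N * K)) L*K≡t+t ⟩
  (t + t) * M + (L * K - ε * N * K)
    ≡⟨ cong (_+ (L * K - ε * N * K)) (solve 2 (λ t M → (t :+ t) :* M := t :* (M :+ M)) refl t M) ⟩
  t * (M + M) + (L * K - ε * N * K)
    ≤⟨ ℚₚ.+-monoʳ-≤ (t * (M + M)) excess≤0 ⟩
  t * (M + M) + 0ℚ
    ≡⟨ ℚₚ.+-identityʳ (t * (M + M)) ⟩
  t * (M + M)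
    ≤⟨ proj₂ (antichain-load-lowerBound w realiser) ⟩
  K * N * ℓ
    ≡⟨ ℚₚ.*-comm (K * N) ℓ ⟩
  ℓ * (K * N) ∎)
  where
  open ℚₚ.≤-Reasoning
  open ℚSolver.+-*-Solver
  k : ℕ
  k = suc j
  L K M N t : ℚ
  L = limitValue (suc k) t≥2
  K = fromℕ k
  M = fromℕ m
  N = fromℕ (suc m)
  t = fromℕ (suc k)
  x : Fin (suc m)
  x = proj₁ (antichain-load-lowerBound w realiser)
  ℓ : ℚ
  ℓ = load w x
  L*K≡t+t : L * K ≡ t + t
  L*K≡t+t = trans (a/d*d≡a (2 ℕ.* suc k) k) (fromℕ-2* (suc k))
  excess≤0 : L * K - ε * N * K ℚ.≤ 0ℚ
  excess≤0 = begin
    L * K - ε * N * K         ≤⟨ ℚₚ.+-monoˡ-≤ (ℚ.- (ε * N * K)) (ℚₚ.*-monoʳ-≤-nonNeg K {{ℚ.nonNegative (fromℕ-nonNeg k)}} L≤ε*n) ⟩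
    ε * N * K - ε * N * K     ≡⟨ ℚₚ.+-inverseʳ (ε * N * K) ⟩
    0ℚ                        ∎

fdim≤⇒fldim≤ : ∀ {n t} {R : Fin n → Fin n → Set} {c} → FDimAtMost t R c → FLDimAtMost t R c
fdim≤⇒fldim≤ (w , (localRealiser , _) , load≤) = w , localRealiser , load≤

fldim≥⇒fdim≥ : ∀ {n t} {R : Fin n → Fin n → Set} {c} → FLDimAtLeast t R c → FDimAtLeast t R c
fldim≥⇒fdim≥ lower w (localRealiser , _) = lower w localRealiser

fdim≤-mono : ∀ {n t} {R : Fin n → Fin n → Set} {c d} → c ℚ.≤ d → FDimAtMost t R c → FDimAtMost t R d
fdim≤-mono c≤d (w , realiser , load≤) = w , realiser , λ x → ℚₚ.≤-trans (load≤ x) c≤d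

proposition10 : (t : ℕ) (t≥2 : 2 ≤ t) (ε : ℚ) → 0ℚ < ε →
    ∃ λ (N : ℕ) → ∀ (n : ℕ) → N ≤ n →
      (FDimAtMost t (Antichain n) (limitValue t t≥2 + ε) × FDimAtLeast t (Antichain n) (limitValue t t≥2 - ε))
      × (FLDimAtMost t (Antichain n) (limitValue t t≥2 + ε) × FLDimAtLeast t (Antichain n) (limitValue t t≥2 - ε))
proposition10 t t≥2 ε 0<ε = suc N , bounds
  where
  L : ℚ
  L = limitValue t t≥2
  N : ℕ
  N = proj₁ (archimedean (2 ℕ.* t) ε 0<ε)

  upper : ∀ n → FDimAtMost t (Antichain n) (L + ε)
  upper n = fdim≤-mono (ℚₚ.≤-trans (ℚₚ.≤-reflexive (sym (ℚₚ.+-identityʳ L))) (ℚₚ.+-monoʳ-≤ L (ℚₚ.<⇒≤ 0<ε)))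
                       (antichain-fdim≤ t t≥2 n)

  lower : ∀ m → N ≤ suc m → FLDimAtLeast t (Antichain (suc m)) (L - ε)
  lower m N≤n = antichain-fldim≥ t t≥2 m ε
    (ℚₚ.≤-trans (limitValue≤2t t t≥2) (proj₂ (archimedean (2 ℕ.* t) ε 0<ε) (suc m) N≤n))

  bounds : ∀ n → suc N ≤ n →
      (FDimAtMost t (Antichain n) (L + ε) × FDimAtLeast t (Antichain n) (L - ε))
      × (FLDimAtMost t (Antichain n) (L + ε) × FLDimAtLeast t (Antichain n) (L - ε))
  bounds (suc m) (s≤s N≤m) =
    (upper (suc m) , fldim≥⇒fdim≥ (lower m N≤1+m)) , (fdim≤⇒fldim≤ (upper (suc m)) , lower m N≤1+m)
    where
    N≤1+m : N ≤ suc m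
    N≤1+m = ℕₚ.m≤n⇒m≤1+n N≤m
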